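{- Let $S=\{s_1<\cdots<s_{k_1}\}$ and $T=\{t_1<\cdots<t_{k_2}\}$ be nonempty subsets of $\{1,\ldots,n-1\}$ and let $d=\gcd\{s+t\mid s\in S,\ t\in T\}$. For every positive integer $k$ there is an integer $r$ and nonnegative integers $a_{i,j}$ ($1\le i\le k_1$, $1\le j\le k$) and $b_{i,j}$ ($1\le i\le k_2$, $1\le j\le k$) such that for every $j\in\{1,\ldots,k\}$, \[r+jd=\sum_{i=1}^{k_1}a_{i,j}s_i-\sum_{i=1}^{k_2}b_{i,j}t_i,\] and the quantity $f(j)=\sum_{i=1}^{k_1}a_{i,j}+\sum_{i=1}^{k_2}b_{i,j}$ does not depend on $j$. -}

module Defs where

open import Data.Nat using (ℕ; zero; suc; _+_; _<_; _≤_)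
open import Data.Nat.GCD using (gcd)
open import Data.Fin using (Fin)
open import Data.List using (List; foldr; map; concatMap; allFin)
open import Data.Integer as ℤ using (ℤ)

StrictlyIncreasing : ∀ {k} → (Fin k → ℕ) → Set
StrictlyIncreasing {k} x = ∀ (i j : Fin k) → i Data.Fin.< j → x i < x j

InRange : ℕ → ∀ {k} → (Fin k → ℕ) → Set
InRange n {k} x = ∀ (i : Fin k) → 1 ≤ x i × x i < n
  where open import Data.Product using (_×_)

-- gcd of a list of naturals (gcd of the empty list is 0).
gcdList : List ℕ → ℕ
gcdList = foldr gcd 0

sumsList : ∀ {k₁ k₂} → (Fin k₁ → ℕ) → (Fin k₂ → ℕ) → List ℕ
sumsList {k₁} {k₂} s t = concatMap (λ i → map (λ j → s i + t j) (allFin k₂)) (allFin k₁)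

gcdSums : ∀ {k₁ k₂} → (Fin k₁ → ℕ) → (Fin k₂ → ℕ) → ℕ
gcdSums s t = gcdList (sumsList s t)

sumℤ : ∀ {k} → (Fin k → ℤ) → ℤ
sumℤ {k} f = foldr ℤ._+_ (ℤ.+ 0) (map f (allFin k))

sumℕ : ∀ {k} → (Fin k → ℕ) → ℕ
sumℕ {k} f = foldr _+_ 0 (map f (allFin k))

module Submission where

-- A pair of formal combinations  Σ aᵢ sᵢ − Σ bᵢ tᵢ  of equal length (number of terms) is
-- balanced with defect d when their values differ by d.  The defects of balanced pairs form
-- a subgroup of ℤ (add pairs termwise, swap them), and ({sᵢ}, {−tⱼ}) has defect sᵢ + tⱼ, so
-- by Bézout some balanced pair (X, Y) has defect gcd = d.  Then the combinations
-- (j+1)·X + (k−j)·Y, 0 ≤ j ≤ k, all have length (k+1)·|Y| and value (k+1)·value(Y) + (j+1)·d.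

open import Defs
import Algebra.Properties.Semiring.Sum as SemiringSum
open import Data.Fin using (Fin; zero; suc; toℕ)
open import Data.Fin.Properties using (toℕ≤pred[n])
open import Data.Integer using (ℤ; +_; _+_; _-_; _*_; _⊖_)
import Data.Integer as ℤ
import Data.Integer.Properties as ℤ
open import Data.Integer.Tactic.RingSolver using (solve-∀)
open import Data.List as List using (allFin)
open import Data.List.Properties using (map-tabulate)
open import Data.List.Relation.Unary.All using (All; []; _∷_)
open import Data.List.Relation.Unary.All.Properties using (map⁺; concat⁺; tabulate⁺)
open import Data.Nat using (ℕ; zero; suc; _∸_)
import Data.Nat as ℕ
import Data.Nat.Properties as ℕ
open import Algebra.Properties.CommutativeSemigroup ℕ.+-commutativeSemigroup using (interchange)
open import Data.Nat.GCD using (gcd; gcd-GCD; module Bézout)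
open import Data.Product using (Σ; _×_; _,_)
open import Data.Vec.Functional as Vector using (Vector; zipWith; replicate)
open import Function using (id; _∘_)
open import Relation.Binary.PropositionalEquality
  using (_≡_; refl; sym; trans; cong; cong₂; subst; module ≡-Reasoning)

foldr-map-allFin : ∀ {A : Set} (_∙_ : A → A → A) (ε : A) {n} (f : Vector A n) →
                   List.foldr _∙_ ε (List.map f (allFin n)) ≡ Vector.foldr _∙_ ε f
foldr-map-allFin _∙_ ε {n} f = trans (cong (List.foldr _∙_ ε) (map-tabulate id f)) (foldr-tabulate f)
  where
  foldr-tabulate : ∀ {n} (g : Vector _ n) → List.foldr _∙_ ε (List.tabulate g) ≡ Vector.foldr _∙_ ε g
  foldr-tabulate {zero}  g = refl
  foldr-tabulate {suc n} g = cong (g zero ∙_) (foldr-tabulate (g ∘ suc))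

module ℕΣ = SemiringSum ℕ.+-*-semiring
module ℤΣ = SemiringSum ℤ.+-*-semiring

sumℕ≡sum : ∀ {n} (f : Vector ℕ n) → sumℕ f ≡ ℕΣ.sum f
sumℕ≡sum = foldr-map-allFin ℕ._+_ 0

sumℤ≡sum : ∀ {n} (f : Vector ℤ n) → sumℤ f ≡ ℤΣ.sum f
sumℤ≡sum = foldr-map-allFin _+_ ℤ.0ℤ

dot : ∀ {n} → Vector ℕ n → Vector ℕ n → ℤ
dot a u = ℤΣ.sum (λ i → + a i * + u i)

size : ∀ {n} → Vector ℕ n → ℕ
size = ℕΣ.sum

δ : ∀ {n} → Fin n → Vector ℕ n
δ zero    zero    = 1
δ zero    (suc _) = 0
δ (suc _) zero    = 0
δ (suc i) (suc j) = δ i j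

module _ {n} (u : Vector ℕ n) where

  dot-zipWith-+ : ∀ (a b : Vector ℕ n) → dot (zipWith ℕ._+_ a b) u ≡ dot a u + dot b u
  dot-zipWith-+ a b = trans (ℤΣ.sum-cong-≗ {n} distrib) (ℤΣ.∑-distrib-+ {n} _ _)
    where
    distrib : ∀ i → + (a i ℕ.+ b i) * + u i ≡ + a i * + u i + + b i * + u i
    distrib i = trans (cong (_* + u i) (ℤ.pos-+ (a i) (b i))) (ℤ.*-distribʳ-+ (+ u i) (+ a i) (+ b i))

  dot-map-* : ∀ c (a : Vector ℕ n) → dot (Vector.map (c ℕ.*_) a) u ≡ + c * dot a u
  dot-map-* c a = trans (ℤΣ.sum-cong-≗ {n} assoc) (sym (ℤΣ.*-distribˡ-sum {n} (+ c) _))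
    where
    assoc : ∀ i → + (c ℕ.* a i) * + u i ≡ + c * (+ a i * + u i)
    assoc i = trans (cong (_* + u i) (ℤ.pos-* c (a i))) (ℤ.*-assoc (+ c) (+ a i) (+ u i))

dot-zero : ∀ {n} (u : Vector ℕ n) → dot (replicate n 0) u ≡ ℤ.0ℤ
dot-zero {zero}  u = refl
dot-zero {suc n} u = trans (ℤ.+-identityˡ _) (dot-zero (u ∘ suc))

dot-δ : ∀ {n} (i : Fin n) (u : Vector ℕ n) → dot (δ i) u ≡ + u i
dot-δ zero    u = trans (cong₂ _+_ (ℤ.*-identityˡ (+ u zero)) (dot-zero (u ∘ suc))) (ℤ.+-identityʳ _)
dot-δ (suc i) u = trans (ℤ.+-identityˡ _) (dot-δ i (u ∘ suc))

size-δ : ∀ {n} (i : Fin n) → size (δ i) ≡ 1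
size-δ {suc n} zero    = cong suc (ℕΣ.sum-replicate-zero n)
size-δ         (suc i) = size-δ i

record IsAdditiveSubgroup (P : ℤ → Set) : Set where
  field
    0-closed   : P ℤ.0ℤ
    +-closed   : ∀ {x y} → P x → P y → P (x + y)
    neg-closed : ∀ {x} → P x → P (ℤ.- x)

bézout-difference : ∀ {d} x m y n → d ℕ.+ y ℕ.* n ≡ x ℕ.* m → + x * + m - + y * + n ≡ + d
bézout-difference {d} x m y n eq = begin
  + x * + m - + y * + n       ≡⟨ cong₂ _-_ (ℤ.pos-* x m) (ℤ.pos-* y n) ⟨
  + (x ℕ.* m) - + (y ℕ.* n)   ≡⟨ ℤ.[+m]-[+n]≡m⊖n (x ℕ.* m) (y ℕ.* n) ⟩
  x ℕ.* m ⊖ y ℕ.* n           ≡⟨ cong (_⊖ y ℕ.* n) eq ⟨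
  d ℕ.+ y ℕ.* n ⊖ y ℕ.* n     ≡⟨ ℤ.⊖-≥ (ℕ.m≤n+m (y ℕ.* n) d) ⟩
  + (d ℕ.+ y ℕ.* n ∸ y ℕ.* n) ≡⟨ cong +_ (ℕ.m+n∸n≡m d (y ℕ.* n)) ⟩
  + d                         ∎
  where open ≡-Reasoning

module _ {P : ℤ → Set} (subgroup : IsAdditiveSubgroup P) where

  open IsAdditiveSubgroup subgroup

  *-closed : ∀ c {x} → P x → P (+ c * x)
  *-closed zero    {x} _  = subst P (sym (ℤ.*-zeroˡ x)) 0-closed
  *-closed (suc c) {x} px = subst P (sym (ℤ.suc-* (+ c) x)) (+-closed px (*-closed c px))

  gcd-closed : ∀ {m n} → P (+ m) → P (+ n) → P (+ gcd m n)
  gcd-closed {m} {n} pm pn with Bézout.identity (gcd-GCD m n)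
  ... | Bézout.+- x y eq =
    subst P (bézout-difference x m y n eq) (+-closed (*-closed x pm) (neg-closed (*-closed y pn)))
  ... | Bézout.-+ x y eq =
    subst P (bézout-difference y n x m eq) (+-closed (*-closed y pn) (neg-closed (*-closed x pm)))

  gcdList-closed : ∀ {xs} → All (P ∘ +_) xs → P (+ gcdList xs)
  gcdList-closed []       = 0-closed
  gcdList-closed (p ∷ ps) = gcd-closed p (gcdList-closed ps)

All-sumsList : ∀ {P : ℕ → Set} {k₁ k₂} (s : Vector ℕ k₁) (t : Vector ℕ k₂) →
               (∀ i j → P (s i ℕ.+ t j)) → All P (sumsList s t)
All-sumsList s t P-sum = concat⁺ (map⁺ (tabulate⁺ λ i → map⁺ (tabulate⁺ (P-sum i))))

record Combination (k₁ k₂ : ℕ) : Set where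
  constructor combination
  field
    plus  : Vector ℕ k₁
    minus : Vector ℕ k₂

open Combination

module _ {k₁ k₂ : ℕ} where

  infixl 6 _⊕_
  infixl 7 _⊛_

  _⊕_ : Combination k₁ k₂ → Combination k₁ k₂ → Combination k₁ k₂
  X ⊕ Y = combination (zipWith ℕ._+_ (plus X) (plus Y)) (zipWith ℕ._+_ (minus X) (minus Y))

  _⊛_ : ℕ → Combination k₁ k₂ → Combination k₁ k₂
  c ⊛ X = combination (Vector.map (c ℕ.*_) (plus X)) (Vector.map (c ℕ.*_) (minus X))

  ∅ : Combination k₁ k₂
  ∅ = combination (replicate k₁ 0) (replicate k₂ 0)

module _ {k₁ k₂ : ℕ} (s : Vector ℕ k₁) (t : Vector ℕ k₂) where

  value : Combination k₁ k₂ → ℤ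
  value X = dot (plus X) s - dot (minus X) t

  length : Combination k₁ k₂ → ℕ
  length X = size (plus X) ℕ.+ size (minus X)

  value-⊕ : ∀ X Y → value (X ⊕ Y) ≡ value X + value Y
  value-⊕ X Y = trans (cong₂ _-_ (dot-zipWith-+ s (plus X) (plus Y)) (dot-zipWith-+ t (minus X) (minus Y)))
                      (regroup (dot (plus X) s) (dot (plus Y) s) (dot (minus X) t) (dot (minus Y) t))
    where
    regroup : ∀ p q p′ q′ → (p + q) - (p′ + q′) ≡ (p - p′) + (q - q′)
    regroup = solve-∀

  value-⊛ : ∀ c X → value (c ⊛ X) ≡ + c * value X
  value-⊛ c X = trans (cong₂ _-_ (dot-map-* s c (plus X)) (dot-map-* t c (minus X)))
                      (distrib (+ c) (dot (plus X) s) (dot (minus X) t))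
    where
    distrib : ∀ c p q → c * p - c * q ≡ c * (p - q)
    distrib = solve-∀

  length-⊕ : ∀ X Y → length (X ⊕ Y) ≡ length X ℕ.+ length Y
  length-⊕ X Y = trans (cong₂ ℕ._+_ (ℕΣ.∑-distrib-+ (plus X) (plus Y)) (ℕΣ.∑-distrib-+ (minus X) (minus Y)))
                       (interchange (size (plus X)) (size (plus Y)) (size (minus X)) (size (minus Y)))

  length-⊛ : ∀ c X → length (c ⊛ X) ≡ c ℕ.* length X
  length-⊛ c X = sym (trans (ℕ.*-distribˡ-+ c (size (plus X)) (size (minus X)))
                            (cong₂ ℕ._+_ (ℕΣ.*-distribˡ-sum c (plus X)) (ℕΣ.*-distribˡ-sum c (minus X))))

  value≡sumℤ : ∀ X → value X ≡ sumℤ (λ i → + plus X i * + s i) - sumℤ (λ i → + minus X i * + t i)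
  value≡sumℤ X = sym (cong₂ _-_ (sumℤ≡sum (λ i → + plus X i * + s i)) (sumℤ≡sum (λ i → + minus X i * + t i)))

  sumℕ≡length : ∀ X → sumℕ (plus X) ℕ.+ sumℕ (minus X) ≡ length X
  sumℕ≡length X = cong₂ ℕ._+_ (sumℕ≡sum (plus X)) (sumℕ≡sum (minus X))

  record Balanced (d : ℤ) : Set where
    field
      upper lower : Combination k₁ k₂
      length-eq   : length upper ≡ length lower
      value-eq    : value upper ≡ value lower + d

  open Balanced

  balanced-0 : Balanced ℤ.0ℤ
  balanced-0 = record { upper = ∅ ; lower = ∅ ; length-eq = refl ; value-eq = sym (ℤ.+-identityʳ _) }

  balanced-+ : ∀ {d e} → Balanced d → Balanced e → Balanced (d + e)
  balanced-+ {d} {e} B C = record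
    { upper     = upper B ⊕ upper C
    ; lower     = lower B ⊕ lower C
    ; length-eq = begin
        length (upper B ⊕ upper C)            ≡⟨ length-⊕ (upper B) (upper C) ⟩
        length (upper B) ℕ.+ length (upper C) ≡⟨ cong₂ ℕ._+_ (length-eq B) (length-eq C) ⟩
        length (lower B) ℕ.+ length (lower C) ≡⟨ length-⊕ (lower B) (lower C) ⟨
        length (lower B ⊕ lower C)            ∎
    ; value-eq  = begin
        value (upper B ⊕ upper C)                     ≡⟨ value-⊕ (upper B) (upper C) ⟩
        value (upper B) + value (upper C)             ≡⟨ cong₂ _+_ (value-eq B) (value-eq C) ⟩
        (value (lower B) + d) + (value (lower C) + e) ≡⟨ regroup (value (lower B)) d (value (lower C)) e ⟩
        (value (lower B) + value (lower C)) + (d + e) ≡⟨ cong (_+ (d + e)) (value-⊕ (lower B) (lower C)) ⟨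
        value (lower B ⊕ lower C) + (d + e)           ∎
    }
    where
    open ≡-Reasoning
    regroup : ∀ p d q e → (p + d) + (q + e) ≡ (p + q) + (d + e)
    regroup = solve-∀

  balanced-neg : ∀ {d} → Balanced d → Balanced (ℤ.- d)
  balanced-neg {d} B = record
    { upper     = lower B
    ; lower     = upper B
    ; length-eq = sym (length-eq B)
    ; value-eq  = begin
        value (lower B)                 ≡⟨ cancel (value (lower B)) d ⟩
        (value (lower B) + d) - d       ≡⟨ cong (_- d) (value-eq B) ⟨
        value (upper B) + ℤ.- d         ∎
    }
    where
    open ≡-Reasoning
    cancel : ∀ p d → p ≡ (p + d) - d
    cancel = solve-∀

  balanced-sum : ∀ i j → Balanced (+ (s i ℕ.+ t j))
  balanced-sum i j = record
    { upper     = combination (δ i) (replicate k₂ 0)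
    ; lower     = combination (replicate k₁ 0) (δ j)
    ; length-eq = trans (cong₂ ℕ._+_ (size-δ i) (ℕΣ.sum-replicate-zero k₂))
                        (sym (cong₂ ℕ._+_ (ℕΣ.sum-replicate-zero k₁) (size-δ j)))
    ; value-eq  = begin
        dot (δ i) s - dot (replicate k₂ 0) t   ≡⟨ cong₂ _-_ (dot-δ i s) (dot-zero t) ⟩
        + s i - ℤ.0ℤ                           ≡⟨ rearrange (+ s i) (+ t j) ⟩
        (ℤ.0ℤ - + t j) + (+ s i + + t j)       ≡⟨ cong (_+_ (ℤ.0ℤ - + t j)) (ℤ.pos-+ (s i) (t j)) ⟨
        (ℤ.0ℤ - + t j) + + (s i ℕ.+ t j)       ≡⟨ cong₂ (λ p q → (p - q) + + (s i ℕ.+ t j)) (dot-zero s) (dot-δ j t) ⟨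
        dot (replicate k₁ 0) s - dot (δ j) t + + (s i ℕ.+ t j) ∎
    }
    where
    open ≡-Reasoning
    rearrange : ∀ a b → a - ℤ.0ℤ ≡ (ℤ.0ℤ - b) + (a + b)
    rearrange = solve-∀

  balanced-subgroup : IsAdditiveSubgroup Balanced
  balanced-subgroup = record { 0-closed = balanced-0 ; +-closed = balanced-+ ; neg-closed = balanced-neg }

  value-interpolate : ∀ {d N} (B : Balanced d) m e → m ℕ.+ e ≡ N →
                      value (m ⊛ upper B ⊕ e ⊛ lower B) ≡ + N * value (lower B) + + m * d
  value-interpolate {d} B m e refl = begin
    value (m ⊛ upper B ⊕ e ⊛ lower B)
      ≡⟨ value-⊕ (m ⊛ upper B) (e ⊛ lower B) ⟩
    value (m ⊛ upper B) + value (e ⊛ lower B)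
      ≡⟨ cong₂ _+_ (value-⊛ m (upper B)) (value-⊛ e (lower B)) ⟩
    + m * value (upper B) + + e * value (lower B)
      ≡⟨ cong (λ v → + m * v + + e * value (lower B)) (value-eq B) ⟩
    + m * (value (lower B) + d) + + e * value (lower B)
      ≡⟨ regroup (+ m) (+ e) (value (lower B)) d ⟩
    (+ m + + e) * value (lower B) + + m * d
      ≡⟨ cong (λ w → w * value (lower B) + + m * d) (ℤ.pos-+ m e) ⟨
    + (m ℕ.+ e) * value (lower B) + + m * d
      ∎
    where
    open ≡-Reasoning
    regroup : ∀ m e v d → m * (v + d) + e * v ≡ (m + e) * v + m * d
    regroup = solve-∀

  length-interpolate : ∀ {d N} (B : Balanced d) m e → m ℕ.+ e ≡ N →
                       length (m ⊛ upper B ⊕ e ⊛ lower B) ≡ N ℕ.* length (lower B)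
  length-interpolate B m e refl = begin
    length (m ⊛ upper B ⊕ e ⊛ lower B)
      ≡⟨ length-⊕ (m ⊛ upper B) (e ⊛ lower B) ⟩
    length (m ⊛ upper B) ℕ.+ length (e ⊛ lower B)
      ≡⟨ cong₂ ℕ._+_ (length-⊛ m (upper B)) (length-⊛ e (lower B)) ⟩
    m ℕ.* length (upper B) ℕ.+ e ℕ.* length (lower B)
      ≡⟨ cong (λ l → m ℕ.* l ℕ.+ e ℕ.* length (lower B)) (length-eq B) ⟩
    m ℕ.* length (lower B) ℕ.+ e ℕ.* length (lower B)
      ≡⟨ ℕ.*-distribʳ-+ (length (lower B)) m e ⟨
    (m ℕ.+ e) ℕ.* length (lower B)
      ∎
    where open ≡-Reasoning

theorem4p2 : (n k₁ k₂ : ℕ) (s : Fin (suc k₁) → ℕ) (t : Fin (suc k₂) → ℕ) →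
  StrictlyIncreasing s → InRange n s →
  StrictlyIncreasing t → InRange n t →
  (k : ℕ) →
  Σ ℤ λ r →
  Σ (Fin (suc k₁) → Fin (suc k) → ℕ) λ a →
  Σ (Fin (suc k₂) → Fin (suc k) → ℕ) λ b →
    ((j : Fin (suc k)) →
      r + (+ (suc (toℕ j))) * (+ gcdSums s t)
        ≡ sumℤ (λ i → (+ a i j) * (+ s i)) - sumℤ (λ i → (+ b i j) * (+ t i)))
    × ((j j′ : Fin (suc k)) →
        sumℕ (λ i → a i j) ℕ.+ sumℕ (λ i → b i j)
          ≡ sumℕ (λ i → a i j′) ℕ.+ sumℕ (λ i → b i j′))
theorem4p2 _ k₁ k₂ s t _ _ _ _ k =
  + suc k * value s t (lower B) , (λ i j → plus (c j) i) , (λ i j → minus (c j) i) ,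
  (λ j → trans (sym (value-interpolate s t B (m j) (e j) (weights-sum j))) (value≡sumℤ s t (c j))) ,
  (λ j j′ → trans (length-c j) (sym (length-c j′)))
  where
  open Balanced
  B : Balanced s t (+ gcdSums s t)
  B = gcdList-closed (balanced-subgroup s t) (All-sumsList s t (balanced-sum s t))
  m e : Fin (suc k) → ℕ
  m j = suc (toℕ j)
  e j = k ∸ toℕ j
  weights-sum : ∀ j → m j ℕ.+ e j ≡ suc k
  weights-sum j = cong suc (ℕ.m+[n∸m]≡n (toℕ≤pred[n] j))
  c : Fin (suc k) → Combination (suc k₁) (suc k₂)
  c j = m j ⊛ upper B ⊕ e j ⊛ lower B
  length-c : ∀ j → sumℕ (plus (c j)) ℕ.+ sumℕ (minus (c j)) ≡ suc k ℕ.* length s t (lower B)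
  length-c j = trans (sumℕ≡length s t (c j)) (length-interpolate s t B (m j) (e j) (weights-sum j))
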